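{- Let $s$ be a fully normalized ternary string of length $n>3$. Then there is a prefix block-interchange applicable to $s$ that is a $1$-pblockInterchange, i.e. after applying it and normalizing, the resulting string has length $n-1$.
   Context: A ternary string is $s=s[1]\ldots s[n]$ with each $s[i]\in\{0,1,2\}$. A string is normalized if no two adjacent symbols are equal; normalizing means replacing every maximal run of identical adjacent symbols by a single copy. A fully normalized ternary string is a normalized string over $\{0,1,2\}$ in which all three symbols occur. For $1\le x<y\le z\le n$, the prefix block-interchange $\beta(1,x,y,z)$ transforms $s$ into $s[y]\ldots s[z]\,s[x+1]\ldots s[y-1]\,s[1]\ldots s[x]\,s[z+1]\ldots s[n]$. An operation applied to a normalized string of length $n$ is an $l$-pblockInterchange if the normalized form of the result has length $n-l$. -}

module Defs where

open import Data.Nat using (ℕ; zero; suc; _∸_; _≤_; _<_)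
open import Data.Fin using (Fin)
open import Data.Fin.Properties using (_≟_)
open import Data.List using (List; []; _∷_; _++_; take; drop; length)
open import Data.List.Membership.Propositional using (_∈_)
open import Relation.Nullary using (¬_; yes; no)
open import Relation.Binary.PropositionalEquality using (_≡_)
open import Data.Product using (_×_)

Sym : Set
Sym = Fin 3

TString : Set
TString = List Sym

data Normalized : TString → Set where
  nil  : Normalized []
  one  : ∀ a → Normalized (a ∷ [])
  cons : ∀ {a b s} → ¬ a ≡ b → Normalized (b ∷ s) → Normalized (a ∷ b ∷ s)

normFrom : Sym → TString → TString
normFrom a [] = a ∷ []
normFrom a (b ∷ s) with a ≟ b
... | yes _ = normFrom b s
... | no  _ = a ∷ normFrom b s

normalize : TString → TString
normalize [] = []
normalize (a ∷ s) = normFrom a s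

FullyNormalized : TString → Set
FullyNormalized s = Normalized s × (∀ (c : Sym) → c ∈ s)

-- prefix block-interchange β(1,x,y,z) (1-indexed positions):
--   s[y..z] ++ s[x+1..y-1] ++ s[1..x] ++ s[z+1..n]
pblockInterchange : ℕ → ℕ → ℕ → TString → TString
pblockInterchange x y z s =
  drop (y ∸ 1) (take z s) ++ drop x (take (y ∸ 1) s) ++ take x s ++ drop z s

ValidPBI : ℕ → ℕ → ℕ → ℕ → Set
ValidPBI n x y z = 1 ≤ x × x < y × y ≤ z × z ≤ n

module Submission where

-- A normalized string  a b c d …  of length at least four always admits a
-- prefix block-interchange that creates exactly one pair of equal adjacent
-- symbols while keeping every other neighbourhood distinct, so that
-- normalizing the result removes exactly one symbol.  Because only three
-- symbols exist and a ≠ b ≠ c ≠ d, one of three cases occurs: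
--   c = a :  β(1,1,2,2) gives  b a a d …   (= b c c d …),
--   d = a :  β(1,1,2,3) gives  b c a a …   (= b c d d …),
--   otherwise d = b (the third symbol) and β(1,2,3,3) gives  c a b b … .
-- Note that only normality of s is used, not that all three symbols occur.

open import Defs
open import Data.Nat using (_<_; _∸_; s≤s; z≤n)
open import Data.Fin.Properties using (_≟_; all?)
open import Data.List using ([]; _∷_; _++_; length)
open import Data.Product using (∃-syntax; _×_; _,_)
open import Data.Empty using (⊥-elim)
open import Relation.Nullary using (yes; no)
open import Relation.Nullary.Decidable using (from-yes; ¬?; _→-dec_)
open import Relation.Binary.PropositionalEquality using (_≡_; _≢_; refl; sym; cong)

third-symbol : ∀ (a b c d : Sym) →
  a ≢ b → b ≢ c → c ≢ a → d ≢ a → d ≢ c → d ≡ b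
third-symbol = from-yes
  (all? λ (a : Sym) → all? λ (b : Sym) → all? λ (c : Sym) → all? λ (d : Sym) →
     ¬? (a ≟ b) →-dec ¬? (b ≟ c) →-dec ¬? (c ≟ a) →-dec
     ¬? (d ≟ a) →-dec ¬? (d ≟ c) →-dec d ≟ b)

normFrom-equal : ∀ a v → normFrom a (a ∷ v) ≡ normFrom a v
normFrom-equal a v with a ≟ a
... | yes _ = refl
... | no a≢a = ⊥-elim (a≢a refl)

normFrom-distinct : ∀ {a b} v → a ≢ b → normFrom a (b ∷ v) ≡ a ∷ normFrom b v
normFrom-distinct {a} {b} v a≢b with a ≟ b
... | yes a≡b = ⊥-elim (a≢b a≡b)
... | no _ = refl

normalize-normalized : ∀ a w → Normalized (a ∷ w) → normFrom a w ≡ a ∷ w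
normalize-normalized a [] _ = refl
normalize-normalized a (b ∷ w) (cons a≢b nw)
  rewrite normFrom-distinct w a≢b | normalize-normalized b w nw = refl

normalize-stutter : ∀ u c v → Normalized (u ++ c ∷ v) →
  normalize (u ++ c ∷ c ∷ v) ≡ u ++ c ∷ v
normalize-stutter [] c v nv
  rewrite normFrom-equal c v = normalize-normalized c v nv
normalize-stutter (a ∷ []) c v (cons a≢c nv)
  rewrite normFrom-distinct (c ∷ v) a≢c | normFrom-equal c v
        | normalize-normalized c v nv = refl
normalize-stutter (a ∷ b ∷ u) c v (cons a≢b nu)
  rewrite normFrom-distinct (u ++ c ∷ c ∷ v) a≢b
  = cong (a ∷_) (normalize-stutter (b ∷ u) c v nu)

one-reduction : ∀ a b c d rest → Normalized (a ∷ b ∷ c ∷ d ∷ rest) →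
  ∃[ x ] ∃[ y ] ∃[ z ] (ValidPBI (length (a ∷ b ∷ c ∷ d ∷ rest)) x y z ×
    length (normalize (pblockInterchange x y z (a ∷ b ∷ c ∷ d ∷ rest)))
      ≡ length (a ∷ b ∷ c ∷ d ∷ rest) ∸ 1)
one-reduction a b c d rest (cons a≢b (cons b≢c (cons c≢d nd))) with c ≟ a
... | yes refl =
  1 , 2 , 2 , (s≤s z≤n , s≤s (s≤s z≤n) , s≤s (s≤s z≤n) , s≤s (s≤s z≤n)) ,
  cong length (normalize-stutter (b ∷ []) c (d ∷ rest)
                 (cons (λ b≡a → a≢b (sym b≡a)) (cons c≢d nd)))
... | no c≢a with d ≟ a
...   | yes refl =
  1 , 2 , 3 , (s≤s z≤n , s≤s (s≤s z≤n) , s≤s (s≤s z≤n) , s≤s (s≤s (s≤s z≤n))) ,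
  cong length (normalize-stutter (b ∷ c ∷ []) d rest (cons b≢c (cons c≢a nd)))
...   | no d≢a with third-symbol a b c d a≢b b≢c c≢a d≢a (λ d≡c → c≢d (sym d≡c))
...     | refl =
  2 , 3 , 3 , (s≤s z≤n , s≤s (s≤s (s≤s z≤n)) , s≤s (s≤s (s≤s z≤n)) , s≤s (s≤s (s≤s z≤n))) ,
  cong length (normalize-stutter (c ∷ a ∷ []) d rest (cons c≢a (cons a≢b nd)))

lemma4 : ∀ (s : TString) → FullyNormalized s → 3 < length s →
    ∃[ x ] ∃[ y ] ∃[ z ] (ValidPBI (length s) x y z ×
      length (normalize (pblockInterchange x y z s)) ≡ length s ∸ 1)
lemma4 (a ∷ b ∷ c ∷ d ∷ rest) (normalized , _) _ = one-reduction a b c d rest normalized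
lemma4 (_ ∷ _ ∷ _ ∷ []) _ (s≤s (s≤s (s≤s ())))
lemma4 (_ ∷ _ ∷ []) _ (s≤s (s≤s ()))
lemma4 (_ ∷ []) _ (s≤s ())
lemma4 [] _ ()
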